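{- Let $\mathcal{L}$ be a $\mathrm{FOL}_{\cong}$-signature and $K$ a sort with $h(K)\ge2$, and let $x\cong_K y$ abbreviate the formula $\exists p:x\cong_K y.\top$. Then this formula is reflexive, symmetric and transitive in $\mathcal{D}_{\cong}$: the sequents $\Gamma,x:K\mid\top\Rightarrow x\cong_K x$, $\ \Gamma,x:K,y:K\mid x\cong_K y\Rightarrow y\cong_K x$, and $\Gamma,x:K,y:K,z:K\mid (x\cong_K y)\wedge(y\cong_K z)\Rightarrow x\cong_K z$ are derivable in $\mathcal{D}_{\cong}$.
   Context: A $\mathrm{FOL}_{\cong}$-signature is an inverse category with a proper order (FOLDS signature) whose sorts carry $h$-levels in $\mathbb{N}\cup\{\infty\}$ and which contains, for every sort $K$ with $h(K)\ge2$, an isomorphism sort $\cong_K$ (source/target arrows $s_K,t_K\colon{\cong_K}\to K$) and a reflexivity sort $\rho_K$ over $\cong_K$ ($\rho(q)$ abbreviating $\exists w:\rho_K(q).\top$ for $q:x\cong_K x$), and for every top-level arrow $f\colon A\to K$ with $h(K)\ge2$ a transport sort $\tau_f$ (formula $\tau(q,\alpha,\beta)$). $\mathcal{D}_{\cong}$ consists of the intuitionistic FOLDS sequent rules (identity, substitution along context morphisms, cut, weakening, exchange, $\top$, $\bot$, $\exists x:K.\phi\Rightarrow\exists x:K.\top$, and the bidirectional rules for $\wedge,\vee,\to,\forall,\exists$: $\theta\Rightarrow\phi\wedge\psi$ iff $\theta\Rightarrow\phi$ and $\theta\Rightarrow\psi$; $\phi\vee\psi\Rightarrow\theta$ iff $\phi\Rightarrow\theta$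 and $\psi\Rightarrow\theta$; $\theta\Rightarrow\phi\to\psi$ iff $\theta\wedge\phi\Rightarrow\psi$; $\Gamma\mid\theta\Rightarrow\forall x:K.\phi$ iff $\Gamma,x:K\mid\theta\Rightarrow\phi$; $\Gamma\mid\exists x:K.\phi\Rightarrow\theta$ iff $\Gamma,x:K\mid\phi\Rightarrow\theta$) plus: $(\rho)$ $\Gamma,x:K\mid\theta\Rightarrow\exists q:x\cong x.\rho(q)$; $(\tau\rho)$ $\Gamma,x:K,\alpha:A,q:x\cong x\mid\rho(q)\wedge\theta\Rightarrow\tau(q,\alpha,\alpha)$; (J) from $\Gamma,x:K,q:x\cong x\mid\rho(q)\wedge\theta[x,x,q]\Rightarrow\phi[x,x,q]$ infer $\Gamma,x:K,y:K,p:x\cong y\mid\theta\Rightarrow\phi$, where $[x,x,q]$ denotes substitution $y\mapsto x$, $p\mapsto q$. -}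

module Defs where

open import Data.Nat using (ℕ; _≤_; _<_)
open import Data.Unit using () renaming (⊤ to Unit)
open import Data.Product using (Σ; _×_; _,_)
open import Data.Sum using (_⊎_; inj₁; inj₂)
open import Data.List using (List)
open import Data.List.Membership.Propositional using (_∈_)
open import Relation.Binary.PropositionalEquality using (_≡_; refl; subst; cong)

data ℕ∞ : Set where
  fin : ℕ → ℕ∞
  ∞   : ℕ∞

_≤∞_ : ℕ → ℕ∞ → Set
m ≤∞ fin n = m ≤ n
m ≤∞ ∞     = Unit

record FOLSig : Set₁ where
  infixr 9 _∘_
  field
    Sort  : Set
    Hom   : Sort → Sort → Set
    id    : ∀ {K} → Hom K K
    _∘_   : ∀ {K M N} → Hom M N → Hom K M → Hom K N
    identityˡ : ∀ {K M} (f : Hom K M) → id ∘ f ≡ f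
    identityʳ : ∀ {K M} (f : Hom K M) → f ∘ id ≡ f
    assoc     : ∀ {K M N P} (h : Hom N P) (g : Hom M N) (f : Hom K M) →
                (h ∘ g) ∘ f ≡ h ∘ (g ∘ f)
    -- inverse category: a rank function (the well-founded order on sorts)
    -- strictly decreased by every non-identity arrow
    rank    : Sort → ℕ
    inverse : ∀ {K M} (f : Hom K M) →
              rank M < rank K ⊎ Σ (M ≡ K) (λ e → subst (Hom K) e f ≡ id)
    arrowsOut         : (K : Sort) → List (Σ Sort (Hom K))
    arrowsOut-complete : ∀ {K M} (f : Hom K M) → (M , f) ∈ arrowsOut K

    hlevel : Sort → ℕ∞

    Iso     : (K : Sort) → 2 ≤∞ hlevel K → Sort
    src tgt : ∀ {K} (hK : 2 ≤∞ hlevel K) → Hom (Iso K hK) K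
    Iso-rank : ∀ {K} (hK : 2 ≤∞ hlevel K) → rank K < rank (Iso K hK)
    Iso-eq   : ∀ {K} (hK : 2 ≤∞ hlevel K) {M} (f : Hom K M) → rank M < rank K →
               f ∘ src hK ≡ f ∘ tgt hK
    Iso-view : ∀ {K} (hK : 2 ≤∞ hlevel K) {M} (g : Hom (Iso K hK) M) →
               rank M < rank (Iso K hK) →
                 Σ (K ≡ M) (λ e → g ≡ subst (Hom (Iso K hK)) e (src hK))
               ⊎ Σ (K ≡ M) (λ e → g ≡ subst (Hom (Iso K hK)) e (tgt hK))
               ⊎ Σ (Hom K M) (λ f → rank M < rank K × g ≡ f ∘ src hK)

    Rho     : (K : Sort) → 2 ≤∞ hlevel K → Sort
    rarr    : ∀ {K} (hK : 2 ≤∞ hlevel K) → Hom (Rho K hK) (Iso K hK)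
    Rho-rank : ∀ {K} (hK : 2 ≤∞ hlevel K) → rank (Iso K hK) < rank (Rho K hK)
    Rho-eq   : ∀ {K} (hK : 2 ≤∞ hlevel K) → src hK ∘ rarr hK ≡ tgt hK ∘ rarr hK
    Rho-view : ∀ {K} (hK : 2 ≤∞ hlevel K) {M} (g : Hom (Rho K hK) M) →
               rank M < rank (Rho K hK) →
                 Σ (Iso K hK ≡ M) (λ e → g ≡ subst (Hom (Rho K hK)) e (rarr hK))
               ⊎ Σ (Hom (Iso K hK) M) (λ h → rank M < rank (Iso K hK) × g ≡ h ∘ rarr hK)

    TopLevel : ∀ {A K} → Hom A K → Set
    TopLevel-rank : ∀ {A K} (f : Hom A K) → TopLevel f → rank K < rank A
    Tau  : ∀ {A K} (f : Hom A K) → TopLevel f → (hK : 2 ≤∞ hlevel K) → Sort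
    -- τ_f(q, α, β) :  q : x ≅_K y ,  α : A over x ,  β : A over y
    tq   : ∀ {A K} (f : Hom A K) (tl : TopLevel f) (hK : 2 ≤∞ hlevel K) →
           Hom (Tau f tl hK) (Iso K hK)
    tα tβ : ∀ {A K} (f : Hom A K) (tl : TopLevel f) (hK : 2 ≤∞ hlevel K) →
           Hom (Tau f tl hK) A
    Tau-rankq : ∀ {A K} (f : Hom A K) (tl : TopLevel f) (hK : 2 ≤∞ hlevel K) →
                rank (Iso K hK) < rank (Tau f tl hK)
    Tau-rankA : ∀ {A K} (f : Hom A K) (tl : TopLevel f) (hK : 2 ≤∞ hlevel K) →
                rank A < rank (Tau f tl hK)
    Tau-eqα : ∀ {A K} (f : Hom A K) (tl : TopLevel f) (hK : 2 ≤∞ hlevel K) →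
              f ∘ tα f tl hK ≡ src hK ∘ tq f tl hK
    Tau-eqβ : ∀ {A K} (f : Hom A K) (tl : TopLevel f) (hK : 2 ≤∞ hlevel K) →
              f ∘ tβ f tl hK ≡ tgt hK ∘ tq f tl hK
    Tau-view : ∀ {A K} (f : Hom A K) (tl : TopLevel f) (hK : 2 ≤∞ hlevel K)
               {M} (g : Hom (Tau f tl hK) M) → rank M < rank (Tau f tl hK) →
                 Σ (Iso K hK ≡ M) (λ e → g ≡ subst (Hom (Tau f tl hK)) e (tq f tl hK))
               ⊎ Σ (A ≡ M) (λ e → g ≡ subst (Hom (Tau f tl hK)) e (tα f tl hK))
               ⊎ Σ (A ≡ M) (λ e → g ≡ subst (Hom (Tau f tl hK)) e (tβ f tl hK))
               ⊎ Σ (Hom (Iso K hK) M) (λ h → rank M < rank (Iso K hK) × g ≡ h ∘ tq f tl hK)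
               ⊎ Σ (Hom A M) (λ h → rank M < rank A × g ≡ h ∘ tα f tl hK)
               ⊎ Σ (Hom A M) (λ h → rank M < rank A × g ≡ h ∘ tβ f tl hK)

module Syntax (L : FOLSig) where
  open FOLSig L public

  -- Contexts: a context extension  Γ ▷ K ∣ d  declares a new variable x : K
  -- whose dependency along each non-identity arrow f : K → M is the variable
  -- d f r of Γ (r witnessing that f lowers the rank).
  infixl 5 _▷_∣_
  data Ctx : Set
  data Var : Ctx → Sort → Set

  data Ctx where
    ε     : Ctx
    _▷_∣_ : (Γ : Ctx) (K : Sort) →
            (∀ {M} (f : Hom K M) → rank M < rank K → Var Γ M) → Ctx

  data Var where
    vz : ∀ {Γ K} {d : ∀ {M} (f : Hom K M) → rank M < rank K → Var Γ M} →
         Var (Γ ▷ K ∣ d) K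
    vs : ∀ {Γ K M} {d : ∀ {N} (f : Hom K N) → rank N < rank K → Var Γ N} →
         Var Γ M → Var (Γ ▷ K ∣ d) M

  Deps : Ctx → Sort → Set
  Deps Γ K = ∀ {M} (f : Hom K M) → rank M < rank K → Var Γ M

  dep : ∀ {Γ K} → Var Γ K → Deps Γ K
  dep (vz {d = d}) f r = vs (d f r)
  dep (vs v)       f r = vs (dep v f r)

  wkD : ∀ {Γ K L'} {e : Deps Γ L'} → Deps Γ K → Deps (Γ ▷ L' ∣ e) K
  wkD d f r = vs (d f r)

  -- context morphisms (morphisms of the underlying L-structures)
  record Mor (Γ Δ : Ctx) : Set where
    field
      ren : ∀ {K} → Var Γ K → Var Δ K
      nat : ∀ {K M} (v : Var Γ K) (f : Hom K M) (r : rank M < rank K) →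
            ren (dep v f r) ≡ dep (ren v) f r
  open Mor public

  substD : ∀ {Γ Δ K} → Mor Γ Δ → Deps Γ K → Deps Δ K
  substD σ d f r = ren σ (d f r)

  lift : ∀ {Γ Δ K} (σ : Mor Γ Δ) (d : Deps Γ K) →
         Mor (Γ ▷ K ∣ d) (Δ ▷ K ∣ substD σ d)
  lift σ d = record { ren = rn ; nat = nt }
    where
    rn : ∀ {M} → Var (_ ▷ _ ∣ d) M → Var (_ ▷ _ ∣ substD σ d) M
    rn vz     = vz
    rn (vs v) = vs (ren σ v)
    nt : ∀ {K M} (v : Var (_ ▷ _ ∣ d) K) (f : Hom K M) (r : rank M < rank K) →
         rn (dep v f r) ≡ dep (rn v) f r
    nt vz     f r = refl
    nt (vs v) f r = cong vs (nat σ v f r)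

  wkM : ∀ {Γ K} (d : Deps Γ K) → Mor Γ (Γ ▷ K ∣ d)
  wkM d = record { ren = vs ; nat = λ v f r → refl }

  -- FOLDS formulas (no atomic formulas besides ⊤, ⊥)
  infixr 6 _∧ᶠ_
  infixr 5 _∨ᶠ_
  infixr 4 _⇒ᶠ_
  data Form (Γ : Ctx) : Set where
    ⊤ᶠ ⊥ᶠ : Form Γ
    _∧ᶠ_ _∨ᶠ_ _⇒ᶠ_ : Form Γ → Form Γ → Form Γ
    ∀ᶠ ∃ᶠ : (K : Sort) (d : Deps Γ K) → Form (Γ ▷ K ∣ d) → Form Γ

  _[_] : ∀ {Γ Δ} → Form Γ → Mor Γ Δ → Form Δ
  ⊤ᶠ [ σ ] = ⊤ᶠ
  ⊥ᶠ [ σ ] = ⊥ᶠ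
  (φ ∧ᶠ ψ) [ σ ] = (φ [ σ ]) ∧ᶠ (ψ [ σ ])
  (φ ∨ᶠ ψ) [ σ ] = (φ [ σ ]) ∨ᶠ (ψ [ σ ])
  (φ ⇒ᶠ ψ) [ σ ] = (φ [ σ ]) ⇒ᶠ (ψ [ σ ])
  ∀ᶠ K d φ [ σ ] = ∀ᶠ K (substD σ d) (φ [ lift σ d ])
  ∃ᶠ K d φ [ σ ] = ∃ᶠ K (substD σ d) (φ [ lift σ d ])

  wk : ∀ {Γ K} {d : Deps Γ K} → Form Γ → Form (Γ ▷ K ∣ d)
  wk {d = d} φ = φ [ wkM d ]

  -- p : x ≅_K y   (x, y : K with the same dependencies; the dependencies of
  -- p along f ∘ s_K = f ∘ t_K are those of x along f)
  isoPick : ∀ {Γ K M} {hK : 2 ≤∞ hlevel K} {g : Hom (Iso K hK) M} →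
            Var Γ K → Var Γ K →
              Σ (K ≡ M) (λ e → g ≡ subst (Hom (Iso K hK)) e (src hK))
            ⊎ Σ (K ≡ M) (λ e → g ≡ subst (Hom (Iso K hK)) e (tgt hK))
            ⊎ Σ (Hom K M) (λ f → rank M < rank K × g ≡ f ∘ src hK) →
            Var Γ M
  isoPick x y (inj₁ (refl , _))              = x
  isoPick x y (inj₂ (inj₁ (refl , _)))       = y
  isoPick x y (inj₂ (inj₂ (f , r , _)))      = dep x f r

  isoD : ∀ {Γ K} (hK : 2 ≤∞ hlevel K) → Var Γ K → Var Γ K → Deps Γ (Iso K hK)
  isoD hK x y g r = isoPick x y (Iso-view hK g r)

  _≅⟨_⟩_ : ∀ {Γ K} → Var Γ K → 2 ≤∞ hlevel K → Var Γ K → Form Γ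
  x ≅⟨ hK ⟩ y = ∃ᶠ (Iso _ hK) (isoD hK x y) ⊤ᶠ

  rhoPick : ∀ {Γ K M} {hK : 2 ≤∞ hlevel K} {g : Hom (Rho K hK) M} →
            Var Γ (Iso K hK) →
              Σ (Iso K hK ≡ M) (λ e → g ≡ subst (Hom (Rho K hK)) e (rarr hK))
            ⊎ Σ (Hom (Iso K hK) M) (λ h → rank M < rank (Iso K hK) × g ≡ h ∘ rarr hK) →
            Var Γ M
  rhoPick q (inj₁ (refl , _))     = q
  rhoPick q (inj₂ (h , r , _))    = dep q h r

  rhoD : ∀ {Γ K} (hK : 2 ≤∞ hlevel K) → Var Γ (Iso K hK) → Deps Γ (Rho K hK)
  rhoD hK q g r = rhoPick q (Rho-view hK g r)

  ρᶠ : ∀ {Γ K} (hK : 2 ≤∞ hlevel K) → Var Γ (Iso K hK) → Form Γ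
  ρᶠ hK q = ∃ᶠ (Rho _ hK) (rhoD hK q) ⊤ᶠ

  tauPick : ∀ {Γ A K M} {f : Hom A K} {tl : TopLevel f} {hK : 2 ≤∞ hlevel K}
            {g : Hom (Tau f tl hK) M} →
            Var Γ (Iso K hK) → Var Γ A → Var Γ A →
              Σ (Iso K hK ≡ M) (λ e → g ≡ subst (Hom (Tau f tl hK)) e (tq f tl hK))
            ⊎ Σ (A ≡ M) (λ e → g ≡ subst (Hom (Tau f tl hK)) e (tα f tl hK))
            ⊎ Σ (A ≡ M) (λ e → g ≡ subst (Hom (Tau f tl hK)) e (tβ f tl hK))
            ⊎ Σ (Hom (Iso K hK) M) (λ h → rank M < rank (Iso K hK) × g ≡ h ∘ tq f tl hK)
            ⊎ Σ (Hom A M) (λ h → rank M < rank A × g ≡ h ∘ tα f tl hK)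
            ⊎ Σ (Hom A M) (λ h → rank M < rank A × g ≡ h ∘ tβ f tl hK) →
            Var Γ M
  tauPick q α β (inj₁ (refl , _))                                = q
  tauPick q α β (inj₂ (inj₁ (refl , _)))                         = α
  tauPick q α β (inj₂ (inj₂ (inj₁ (refl , _))))                  = β
  tauPick q α β (inj₂ (inj₂ (inj₂ (inj₁ (h , r , _)))))          = dep q h r
  tauPick q α β (inj₂ (inj₂ (inj₂ (inj₂ (inj₁ (h , r , _))))))   = dep α h r
  tauPick q α β (inj₂ (inj₂ (inj₂ (inj₂ (inj₂ (h , r , _))))))   = dep β h r

  tauD : ∀ {Γ A K} (f : Hom A K) (tl : TopLevel f) (hK : 2 ≤∞ hlevel K) →
         Var Γ (Iso K hK) → Var Γ A → Var Γ A → Deps Γ (Tau f tl hK)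
  tauD f tl hK q α β g r = tauPick q α β (Tau-view f tl hK g r)

  τᶠ : ∀ {Γ A K} (f : Hom A K) (tl : TopLevel f) (hK : 2 ≤∞ hlevel K) →
       Var Γ (Iso K hK) → Var Γ A → Var Γ A → Form Γ
  τᶠ f tl hK q α β = ∃ᶠ (Tau f tl hK) (tauD f tl hK q α β) ⊤ᶠ

  -- the substitution [x, x, q] used in rule (J):
  --   Γ, x:K, y:K, p:x ≅ y   →   Γ, x:K, q:x ≅ x
  --   (identity on Γ and x,  y ↦ x,  p ↦ q)

  module _ {Γ : Ctx} {K : Sort} (hK : 2 ≤∞ hlevel K) (d : Deps Γ K) where

    CtxXYP : Ctx
    CtxXYP = Γ ▷ K ∣ d ▷ K ∣ wkD d ▷ Iso K hK ∣ isoD hK (vs vz) vz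

    CtxXQ : Ctx
    CtxXQ = Γ ▷ K ∣ d ▷ Iso K hK ∣ isoD hK vz vz

    private
      rnJ : ∀ {M} → Var CtxXYP M → Var CtxXQ M
      rnJ vz                = vz
      rnJ (vs vz)           = vs vz
      rnJ (vs (vs vz))      = vs vz
      rnJ (vs (vs (vs v)))  = vs (vs v)

      natPick : ∀ {M} {g : Hom (Iso K hK) M} (w : _) →
                rnJ (vs (isoPick {g = g} (vs vz) vz w)) ≡ vs (isoPick {g = g} vz vz w)
      natPick (inj₁ (refl , _))         = refl
      natPick (inj₂ (inj₁ (refl , _)))  = refl
      natPick (inj₂ (inj₂ (f , r , _))) = refl

      natJ : ∀ {M N} (v : Var CtxXYP M) (f : Hom M N) (r : rank N < rank M) →
             rnJ (dep v f r) ≡ dep (rnJ v) f r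
      natJ vz               g r = natPick (Iso-view hK g r)
      natJ (vs vz)          f r = refl
      natJ (vs (vs vz))     f r = refl
      natJ (vs (vs (vs v))) f r = refl

    [x,x,q] : Mor CtxXYP CtxXQ
    [x,x,q] = record { ren = rnJ ; nat = natJ }

  -- The deductive system D_≅ :  Der Γ θ φ  means  Γ ∣ θ ⇒ φ  is derivable.

  data Der : (Γ : Ctx) → Form Γ → Form Γ → Set where
    idR   : ∀ {Γ φ} → Der Γ φ φ
    subR  : ∀ {Γ Δ φ ψ} (σ : Mor Γ Δ) → Der Γ φ ψ → Der Δ (φ [ σ ]) (ψ [ σ ])
    cutR  : ∀ {Γ φ ψ χ} → Der Γ φ ψ → Der Γ ψ χ → Der Γ φ χ
    weakR : ∀ {Γ φ ψ θ} → Der Γ φ ψ → Der Γ (φ ∧ᶠ θ) ψ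
    ⊤R    : ∀ {Γ φ} → Der Γ φ ⊤ᶠ
    ⊥L    : ∀ {Γ φ} → Der Γ ⊥ᶠ φ
    ∃⊤R   : ∀ {Γ K} {d : Deps Γ K} {φ} → Der Γ (∃ᶠ K d φ) (∃ᶠ K d ⊤ᶠ)
    ∧I  : ∀ {Γ θ φ ψ} → Der Γ θ φ → Der Γ θ ψ → Der Γ θ (φ ∧ᶠ ψ)
    ∧E₁ : ∀ {Γ θ φ ψ} → Der Γ θ (φ ∧ᶠ ψ) → Der Γ θ φ
    ∧E₂ : ∀ {Γ θ φ ψ} → Der Γ θ (φ ∧ᶠ ψ) → Der Γ θ ψ
    ∨I  : ∀ {Γ θ φ ψ} → Der Γ φ θ → Der Γ ψ θ → Der Γ (φ ∨ᶠ ψ) θ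
    ∨E₁ : ∀ {Γ θ φ ψ} → Der Γ (φ ∨ᶠ ψ) θ → Der Γ φ θ
    ∨E₂ : ∀ {Γ θ φ ψ} → Der Γ (φ ∨ᶠ ψ) θ → Der Γ ψ θ
    ⇒I  : ∀ {Γ θ φ ψ} → Der Γ (θ ∧ᶠ φ) ψ → Der Γ θ (φ ⇒ᶠ ψ)
    ⇒E  : ∀ {Γ θ φ ψ} → Der Γ θ (φ ⇒ᶠ ψ) → Der Γ (θ ∧ᶠ φ) ψ
    ∀I  : ∀ {Γ K} {d : Deps Γ K} {θ φ} → Der (Γ ▷ K ∣ d) (wk θ) φ → Der Γ θ (∀ᶠ K d φ)
    ∀E  : ∀ {Γ K} {d : Deps Γ K} {θ φ} → Der Γ θ (∀ᶠ K d φ) → Der (Γ ▷ K ∣ d) (wk θ) φ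
    ∃I  : ∀ {Γ K} {d : Deps Γ K} {θ φ} → Der (Γ ▷ K ∣ d) φ (wk θ) → Der Γ (∃ᶠ K d φ) θ
    ∃E  : ∀ {Γ K} {d : Deps Γ K} {θ φ} → Der Γ (∃ᶠ K d φ) θ → Der (Γ ▷ K ∣ d) φ (wk θ)
    ρR  : ∀ {Γ K} (hK : 2 ≤∞ hlevel K) (d : Deps Γ K) (θ : Form (Γ ▷ K ∣ d)) →
          Der (Γ ▷ K ∣ d) θ (∃ᶠ (Iso K hK) (isoD hK vz vz) (ρᶠ hK vz))
    -- (τρ)  Γ, x:K, α:A, q:x ≅ x ∣ ρ(q) ∧ θ ⇒ τ(q, α, α)   (α lies over x along f)
    τρR : ∀ {Γ A K} (f : Hom A K) (tl : TopLevel f) (hK : 2 ≤∞ hlevel K)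
          (d : Deps Γ K) (dα : Deps (Γ ▷ K ∣ d) A) →
          dα f (TopLevel-rank f tl) ≡ vz →
          (θ : Form (Γ ▷ K ∣ d ▷ A ∣ dα ▷ Iso K hK ∣ isoD hK (vs vz) (vs vz))) →
          Der (Γ ▷ K ∣ d ▷ A ∣ dα ▷ Iso K hK ∣ isoD hK (vs vz) (vs vz))
              (ρᶠ hK vz ∧ᶠ θ) (τᶠ f tl hK vz (vs vz) (vs vz))
    JR  : ∀ {Γ K} (hK : 2 ≤∞ hlevel K) (d : Deps Γ K)
          (θ φ : Form (CtxXYP hK d)) →
          Der (CtxXQ hK d) (ρᶠ hK vz ∧ᶠ (θ [ [x,x,q] hK d ])) (φ [ [x,x,q] hK d ]) →
          Der (CtxXYP hK d) θ φ

-- Reflexivity is rule (ρ) with the reflexivity witness forgotten. Symmetry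
-- and transitivity go by rule (J): once y is identified with x and p with a
-- reflexivity proof q, the symmetry goal x ≅ x is reflexivity again, and the
-- transitivity goal becomes the tautology x ≅ z ⇒ x ≅ z. Since (J) only
-- eliminates the assumption p : x ≅ y, transitivity is proved for the
-- formula ∀ z. y ≅ z ⇒ x ≅ z, in which z is not free.
module Submission where

open import Defs
open import Data.Nat using (_<_)
open import Data.Product using (_×_; _,_)
open import Data.Sum using (inj₁; inj₂)
open import Relation.Binary.PropositionalEquality using (_≡_; refl; sym; cong)

module _ (L : FOLSig) where
  open Syntax L

  -- Substituting into a formula only changes dependency declarations up to
  -- propositional equality, so renamed formulas are related by derivations.
  ∃⊤-cong : ∀ {Γ M} {d₁ d₂ : Deps Γ M} →
            (∀ {N} (f : Hom M N) (r : rank N < rank M) → d₁ f r ≡ d₂ f r) →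
            Der Γ (∃ᶠ M d₁ ⊤ᶠ) (∃ᶠ M d₂ ⊤ᶠ)
  ∃⊤-cong {Γ} {M} {d₁} {d₂} d₁≗d₂ = ∃I (subR d₂⇒d₁ (∃E idR))
    where
    d₂⇒d₁ : Mor (Γ ▷ M ∣ d₂) (Γ ▷ M ∣ d₁)
    d₂⇒d₁ = record { ren = rn ; nat = nt }
      where
      rn : ∀ {N} → Var (Γ ▷ M ∣ d₂) N → Var (Γ ▷ M ∣ d₁) N
      rn vz     = vz
      rn (vs v) = vs v
      nt : ∀ {K N} (v : Var (Γ ▷ M ∣ d₂) K) (f : Hom K N) (r : rank N < rank K) →
           rn (dep v f r) ≡ dep (rn v) f r
      nt vz     f r = cong vs (sym (d₁≗d₂ f r))
      nt (vs v) f r = refl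

  isoD-ren : ∀ {Γ Δ K} {hK : 2 ≤∞ hlevel K} (σ : Mor Γ Δ) (x y : Var Γ K)
             {M} (g : Hom (Iso K hK) M) (r : rank M < rank (Iso K hK)) →
             ren σ (isoD hK x y g r) ≡ isoD hK (ren σ x) (ren σ y) g r
  isoD-ren {hK = hK} σ x y g r with Iso-view hK g r
  ... | inj₁ (refl , _)         = refl
  ... | inj₂ (inj₁ (refl , _))  = refl
  ... | inj₂ (inj₂ (f , r′ , _)) = nat σ x f r′

  module _ {K : Sort} {hK : 2 ≤∞ hlevel K} where

    ≅-ren : ∀ {Γ Δ} (σ : Mor Γ Δ) {x y : Var Γ K} →
            Der Δ ((x ≅⟨ hK ⟩ y) [ σ ]) (ren σ x ≅⟨ hK ⟩ ren σ y)
    ≅-ren σ {x} {y} = ∃⊤-cong (isoD-ren σ x y)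

    ≅-ren⁻¹ : ∀ {Γ Δ} (σ : Mor Γ Δ) {x y : Var Γ K} →
              Der Δ (ren σ x ≅⟨ hK ⟩ ren σ y) ((x ≅⟨ hK ⟩ y) [ σ ])
    ≅-ren⁻¹ σ {x} {y} = ∃⊤-cong (λ g r → sym (isoD-ren σ x y g r))

    ≅-ren₂ : ∀ {Γ Δ Ξ} (σ : Mor Γ Δ) (τ : Mor Δ Ξ) {x y : Var Γ K} →
             Der Ξ (((x ≅⟨ hK ⟩ y) [ σ ]) [ τ ])
                   (ren τ (ren σ x) ≅⟨ hK ⟩ ren τ (ren σ y))
    ≅-ren₂ σ τ = cutR (subR τ (≅-ren σ)) (≅-ren τ)

    ≅-ren₂⁻¹ : ∀ {Γ Δ Ξ} (σ : Mor Γ Δ) (τ : Mor Δ Ξ) {x y : Var Γ K} →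
               Der Ξ (ren τ (ren σ x) ≅⟨ hK ⟩ ren τ (ren σ y))
                     (((x ≅⟨ hK ⟩ y) [ σ ]) [ τ ])
    ≅-ren₂⁻¹ σ τ = cutR (≅-ren⁻¹ τ) (subR τ (≅-ren⁻¹ σ))

  module _ {Γ : Ctx} {K : Sort} (hK : 2 ≤∞ hlevel K) (d : Deps Γ K) where

    ≅-refl : Der (Γ ▷ K ∣ d) ⊤ᶠ (vz ≅⟨ hK ⟩ vz)
    ≅-refl = cutR (ρR hK d ⊤ᶠ) ∃⊤R

    ≅-sym : Der (Γ ▷ K ∣ d ▷ K ∣ wkD d) (vs vz ≅⟨ hK ⟩ vz) (vz ≅⟨ hK ⟩ vs vz)
    ≅-sym = ∃I (JR hK d ⊤ᶠ (wk (vz ≅⟨ hK ⟩ vs vz)) symmetric-at-q)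
      where
      symmetric-at-q : Der (CtxXQ hK d) (ρᶠ hK vz ∧ᶠ ⊤ᶠ)
                           ((wk (vz ≅⟨ hK ⟩ vs vz)) [ [x,x,q] hK d ])
      symmetric-at-q =
        cutR ⊤R (cutR (subR (wkM _) ≅-refl)
                (cutR (≅-ren (wkM _)) (≅-ren₂⁻¹ (wkM _) ([x,x,q] hK d))))

    ≅-transᶠ : Form (Γ ▷ K ∣ d ▷ K ∣ wkD d)
    ≅-transᶠ = ∀ᶠ K (wkD (wkD d)) ((vs vz ≅⟨ hK ⟩ vz) ⇒ᶠ (vs (vs vz) ≅⟨ hK ⟩ vz))

    ≅-transᶠ-holds : Der (Γ ▷ K ∣ d ▷ K ∣ wkD d) (vs vz ≅⟨ hK ⟩ vz) ≅-transᶠ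
    ≅-transᶠ-holds = ∃I (JR hK d ⊤ᶠ (wk ≅-transᶠ) transitive-at-q)
      where
      transitive-at-q : Der (CtxXQ hK d) (ρᶠ hK vz ∧ᶠ ⊤ᶠ)
                            ((wk ≅-transᶠ) [ [x,x,q] hK d ])
      transitive-at-q =
        ∀I (⇒I (cutR (∧E₂ idR) (cutR (≅-ren₂ (lift (wkM _) _) (lift ([x,x,q] hK d) _))
                                     (≅-ren₂⁻¹ (lift (wkM _) _) (lift ([x,x,q] hK d) _)))))

    ≅-trans : Der (Γ ▷ K ∣ d ▷ K ∣ wkD d ▷ K ∣ wkD (wkD d))
                  ((vs (vs vz) ≅⟨ hK ⟩ vs vz) ∧ᶠ (vs vz ≅⟨ hK ⟩ vz))
                  (vs (vs vz) ≅⟨ hK ⟩ vz)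
    ≅-trans = cutR (∧I (cutR (∧E₁ idR) (≅-ren⁻¹ (wkM _))) (∧E₂ idR))
                   (⇒E (∀E ≅-transᶠ-holds))

corollary5p10 : (L : FOLSig) → let open Syntax L in
    (Γ : Ctx) (K : Sort) (hK : 2 ≤∞ hlevel K) (d : Deps Γ K) →
    Der (Γ ▷ K ∣ d) ⊤ᶠ (vz ≅⟨ hK ⟩ vz)
    × Der (Γ ▷ K ∣ d ▷ K ∣ wkD d)
          (vs vz ≅⟨ hK ⟩ vz) (vz ≅⟨ hK ⟩ vs vz)
    × Der (Γ ▷ K ∣ d ▷ K ∣ wkD d ▷ K ∣ wkD (wkD d))
          ((vs (vs vz) ≅⟨ hK ⟩ vs vz) ∧ᶠ (vs vz ≅⟨ hK ⟩ vz)) (vs (vs vz) ≅⟨ hK ⟩ vz)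
corollary5p10 L Γ K hK d = ≅-refl L hK d , ≅-sym L hK d , ≅-trans L hK d
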